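{- Fix an integer $k\geq2$. For $m\geq1$ let $$y_m(t)=\sum_{T}\rho_m(T)\,t^{d(T)},\qquad \tilde y_m(t)=\sum_T\tilde\rho_m(T)\,t^{d(T)},$$ where $T$ ranges over all (isomorphism classes of) $k$-regular finite rooted planar trees, $d(T)$ is the number of leaves of $T$, $\rho_m(T)$ is the number of restricted morphisms $T\to\{1,\dots,m\}$ and $\tilde\rho_m(T)$ is the number of all morphisms $T\to\{1,\dots,m\}$. Then, as formal power series in $t$, $$y_1(t)=\tilde y_1(t)=t+(y_1(t))^k,\qquad y_m(t)=t+\sum_{h=1}^m(y_h(t))^k,\qquad \tilde y_m(t)=m\,t+\sum_{h=1}^m(\tilde y_h(t))^k.$$
   Context: A finite rooted planar tree has a root, edges oriented away from the root (an edge $e$ from father $\alpha(e)$ to son $\omega(e)$), and totally ordered sons at each vertex; leaves have no sons; it is $k$-regular if every vertex with at least one son has exactly $k$ sons. $\{1,\dots,m\}$ carries its usual total order. A morphism $\mu:T\to\{1,\dots,m\}$ is a map on vertices with $\mu(\omega(e))\ge\mu(\alpha(e))$ for every edge $e$; it is restricted if $\mu^{ -1}(m)$ contains all leaves of $T$. -}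

module Defs where

open import Data.Nat using (ℕ; zero; suc; _+_; _*_; _∸_; _≤ᵇ_; _≡ᵇ_)
open import Data.Bool using (Bool; true; false; _∧_; if_then_else_)
open import Data.Fin using (Fin; toℕ)
open import Data.List using (List; []; _∷_; map; concatMap; upTo; allFin)
open import Data.Nat.ListAction using (sum)
open import Data.Vec using (Vec; []; _∷_)

-- k-regular finite rooted planar trees (up to isomorphism):
-- a vertex is either a leaf or has exactly k ordered sons.

data Tree (k : ℕ) : Set where
  leaf : Tree k
  node : Vec (Tree k) k → Tree k

mutual
  leaves : ∀ {k} → Tree k → ℕ
  leaves leaf      = 1
  leaves (node ts) = leavesV ts

  leavesV : ∀ {k n} → Vec (Tree k) n → ℕ
  leavesV []       = 0
  leavesV (t ∷ ts) = leaves t + leavesV ts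

-- Maps from the vertices of a tree to {1,…,m}: a tree of the same shape
-- with a label in Fin m at every vertex (label i ∈ Fin m stands for i+1).

data LTree (k m : ℕ) : Set where
  lleaf : Fin m → LTree k m
  lnode : Fin m → Vec (LTree k m) k → LTree k m

rootLabel : ∀ {k m} → LTree k m → Fin m
rootLabel (lleaf a)   = a
rootLabel (lnode a _) = a

module _ {k : ℕ} (m : ℕ) where
  mutual
    labellings : Tree k → List (LTree k m)
    labellings leaf      = map lleaf (allFin m)
    labellings (node ts) = concatMap (λ a → map (lnode a) (labellingsV ts)) (allFin m)

    labellingsV : ∀ {n} → Vec (Tree k) n → List (Vec (LTree k m) n)
    labellingsV []       = [] ∷ []
    labellingsV (t ∷ ts) = concatMap (λ l → map (l ∷_) (labellingsV ts)) (labellings t)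

  mutual
    isMorphism : LTree k m → Bool
    isMorphism (lleaf _)    = true
    isMorphism (lnode a ls) = sonsOK a ls

    sonsOK : ∀ {n} → Fin m → Vec (LTree k m) n → Bool
    sonsOK a []       = true
    sonsOK a (l ∷ ls) = (toℕ a ≤ᵇ toℕ (rootLabel l)) ∧ isMorphism l ∧ sonsOK a ls

  mutual
    -- all leaves are sent to m (i.e. to the label with toℕ = m ∸ 1)
    leavesAtTop : LTree k m → Bool
    leavesAtTop (lleaf a)    = toℕ a ≡ᵇ (m ∸ 1)
    leavesAtTop (lnode _ ls) = leavesAtTopV ls

    leavesAtTopV : ∀ {n} → Vec (LTree k m) n → Bool
    leavesAtTopV []       = true
    leavesAtTopV (l ∷ ls) = leavesAtTop l ∧ leavesAtTopV ls

count : {A : Set} → (A → Bool) → List A → ℕ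
count p xs = sum (map (λ x → if p x then 1 else 0) xs)

ρ̃ : ∀ {k} → ℕ → Tree k → ℕ
ρ̃ m T = count (isMorphism m) (labellings m T)

ρ : ∀ {k} → ℕ → Tree k → ℕ
ρ m T = count (λ μ → isMorphism m μ ∧ leavesAtTop m μ) (labellings m T)

vecsOver : {A : Set} → (n : ℕ) → List A → List (Vec A n)
vecsOver zero    xs = [] ∷ []
vecsOver (suc n) xs = concatMap (λ x → map (x ∷_) (vecsOver n xs)) xs

treesUpTo : (k : ℕ) → ℕ → List (Tree k)
treesUpTo k zero    = leaf ∷ []
treesUpTo k (suc h) = leaf ∷ map node (vecsOver k (treesUpTo k h))

Series : Set
Series = ℕ → ℕ

_≋_ : Series → Series → Set
f ≋ g = ∀ n → f n ≡ g n
  where open import Relation.Binary.PropositionalEquality using (_≡_)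

infix 4 _≋_
infixl 6 _⊕_
infixl 7 _⊛_ _·_

tS : Series
tS n = if n ≡ᵇ 1 then 1 else 0

_⊕_ : Series → Series → Series
(f ⊕ g) n = f n + g n

_·_ : ℕ → Series → Series
(c · f) n = c * f n

_⊛_ : Series → Series → Series
(f ⊛ g) n = sum (map (λ i → f i * g (n ∸ i)) (upTo (suc n)))

oneS : Series
oneS n = if n ≡ᵇ 0 then 1 else 0

_^S_ : Series → ℕ → Series
f ^S zero  = oneS
f ^S suc j = f ⊛ (f ^S j)

ΣS : ℕ → (ℕ → Series) → Series
ΣS zero    f = λ _ → 0
ΣS (suc m) f = ΣS m f ⊕ f (suc m)

-- Every k-regular tree (k ≥ 2) with n leaves has fewer than n internal
-- vertices, hence height ≤ n, so it occurs (exactly once) in treesUpTo k n.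
y : (k m : ℕ) → Series
y k m n = sum (map (λ T → if leaves T ≡ᵇ n then ρ m T else 0) (treesUpTo k n))

ỹ : (k m : ℕ) → Series
ỹ k m n = sum (map (λ T → if leaves T ≡ᵇ n then ρ̃ m T else 0) (treesUpTo k n))

{-# OPTIONS --safe #-}
-- A morphism T → {1,…,p} whose root takes the value p + 1 − h is, after shifting every label down by
-- p − h, a morphism T → {1,…,h} sending the root to 1, i.e. an independent choice of a morphism of
-- each of the k subtrees into {1,…,h}. So the counts obey ρ_p(node t₁…t_k) = Σ_{h=1}^p Π_i ρ_h(t_i),
-- with p morphisms (one restricted morphism, p ≥ 1) on a single leaf; for p = 1 every map is
-- restricted. Counting trees by leaves, k-tuples of subtrees are counted by the k-th Cauchy power,
-- which turns the recursion into the functional equations. Enumerating trees by height loses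
-- nothing: a tree of height H + 1 has at least H + 2 leaves.
module Submission where

open import Defs
open import Data.Nat using (ℕ; _≤_)
open import Data.Product using (_×_)

open import Algebra.Bundles using (CommutativeMonoid)
open import Data.Bool using (Bool; true; false; _∧_; if_then_else_)
open import Data.Bool.Properties using (∧-assoc; ∧-identityʳ; ∧-commutativeMonoid)
open import Data.Fin using (Fin; toℕ) renaming (zero to fzero; suc to fsuc)
open import Data.List using (List; []; _∷_; _++_; map; concatMap; upTo; applyDownFrom; allFin)
open import Data.List.Properties
  using (map-++; map-cong; map-cong-local; map-∘; map-applyUpTo; map-upTo; map-tabulate)
open import Data.List.Relation.Unary.All.Properties using (applyUpTo⁺₁)
open import Data.Nat using (zero; suc; _+_; _*_; _∸_; _<_; _≤ᵇ_; _≡ᵇ_; z≤n; s≤s; s≤s⁻¹)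
open import Data.Nat.ListAction using (sum)
open import Data.Nat.ListAction.Properties using (sum-++)
open import Data.Nat.Properties
open import Data.Product using (_,_)
open import Data.Sum using (inj₁; inj₂)
open import Data.Vec using (Vec; []; _∷_)
open import Function using (id; _∘_)
open import Relation.Binary.PropositionalEquality
open import Algebra.Properties.CommutativeSemigroup +-commutativeSemigroup
  using () renaming (interchange to +-interchange)
open import Algebra.Properties.CommutativeSemigroup
  (CommutativeMonoid.commutativeSemigroup ∧-commutativeMonoid)
  using () renaming (interchange to ∧-interchange)

private variable
  A B : Set

ind : Bool → ℕ → ℕ
ind b v = if b then v else 0

∑ : List A → (A → ℕ) → ℕ
∑ xs f = sum (map f xs)

syntax ∑ xs (λ x → e) = ∑[ x ∈ xs ] e

∑-cong : ∀ (xs : List A) {f g : A → ℕ} → (∀ x → f x ≡ g x) → ∑ xs f ≡ ∑ xs g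
∑-cong xs f≗g = cong sum (map-cong f≗g xs)

∑-vanish : ∀ (xs : List A) {f : A → ℕ} → (∀ x → f x ≡ 0) → ∑ xs f ≡ 0
∑-vanish []       f≗0 = refl
∑-vanish (x ∷ xs) f≗0 = cong₂ _+_ (f≗0 x) (∑-vanish xs f≗0)

∑-map : ∀ (h : A → B) (xs : List A) (f : B → ℕ) → ∑ (map h xs) f ≡ ∑[ x ∈ xs ] f (h x)
∑-map h xs f = cong sum (sym (map-∘ xs))

∑-++ : ∀ (xs ys : List A) (f : A → ℕ) → ∑ (xs ++ ys) f ≡ ∑ xs f + ∑ ys f
∑-++ xs ys f = trans (cong sum (map-++ f xs ys)) (sum-++ (map f xs) (map f ys))

∑-concatMap : ∀ (g : A → List B) (xs : List A) (f : B → ℕ) →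
              ∑ (concatMap g xs) f ≡ ∑[ x ∈ xs ] ∑ (g x) f
∑-concatMap g []       f = refl
∑-concatMap g (x ∷ xs) f =
  trans (∑-++ (g x) _ f) (cong (∑ (g x) f +_) (∑-concatMap g xs f))

∑-+ : ∀ (xs : List A) (f g : A → ℕ) → ∑[ x ∈ xs ] (f x + g x) ≡ ∑ xs f + ∑ xs g
∑-+ []       f g = refl
∑-+ (x ∷ xs) f g =
  trans (cong (f x + g x +_) (∑-+ xs f g)) (+-interchange (f x) (g x) _ _)

*-distribˡ-∑ : ∀ c (xs : List A) (f : A → ℕ) → c * ∑ xs f ≡ ∑[ x ∈ xs ] (c * f x)
*-distribˡ-∑ c []       f = *-zeroʳ c
*-distribˡ-∑ c (x ∷ xs) f =
  trans (*-distribˡ-+ c (f x) _) (cong (c * f x +_) (*-distribˡ-∑ c xs f))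

*-distribʳ-∑ : ∀ c (xs : List A) (f : A → ℕ) → ∑ xs f * c ≡ ∑[ x ∈ xs ] (f x * c)
*-distribʳ-∑ c []       f = refl
*-distribʳ-∑ c (x ∷ xs) f =
  trans (*-distribʳ-+ c (f x) _) (cong (f x * c +_) (*-distribʳ-∑ c xs f))

∑-*-∑ : ∀ (xs : List A) (ys : List B) (f : A → ℕ) (g : B → ℕ) →
        ∑ xs f * ∑ ys g ≡ ∑[ x ∈ xs ] ∑[ y ∈ ys ] (f x * g y)
∑-*-∑ xs ys f g =
  trans (*-distribʳ-∑ (∑ ys g) xs f) (∑-cong xs (λ x → *-distribˡ-∑ (f x) ys g))

∑-comm : ∀ (xs : List A) (ys : List B) (g : A → B → ℕ) →
         ∑[ x ∈ xs ] ∑[ y ∈ ys ] g x y ≡ ∑[ y ∈ ys ] ∑[ x ∈ xs ] g x y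
∑-comm []       ys g = sym (∑-vanish ys (λ _ → refl))
∑-comm (x ∷ xs) ys g =
  trans (cong (∑ ys (g x) +_) (∑-comm xs ys g)) (sym (∑-+ ys (g x) _))

ind-∑ : ∀ b (xs : List A) (f : A → ℕ) → ind b (∑ xs f) ≡ ∑[ x ∈ xs ] ind b (f x)
ind-∑ true  xs f = refl
ind-∑ false xs f = sym (∑-vanish xs (λ _ → refl))

count-const-∧ : ∀ c (p : A → Bool) (xs : List A) → count (λ x → c ∧ p x) xs ≡ ind c (count p xs)
count-const-∧ true  p xs = refl
count-const-∧ false p xs = ∑-vanish xs (λ _ → refl)

ind-∧ : ∀ b c v → ind (b ∧ c) v ≡ ind b (ind c v)
ind-∧ true  c v = refl
ind-∧ false c v = refl

oneTo : ℕ → List ℕ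
oneTo = applyDownFrom suc

ΣS-oneTo : ∀ m (F : ℕ → Series) n → ΣS m F n ≡ ∑[ h ∈ oneTo m ] F h n
ΣS-oneTo zero    F n = refl
ΣS-oneTo (suc m) F n = trans (+-comm (ΣS m F n) _) (cong (F (suc m) n +_) (ΣS-oneTo m F n))

∑-oneTo-1 : ∀ m → ∑[ h ∈ oneTo m ] 1 ≡ m
∑-oneTo-1 zero    = refl
∑-oneTo-1 (suc m) = cong suc (∑-oneTo-1 m)

∑-oneTo-≡ᵇ1 : ∀ m → ∑[ h ∈ oneTo (suc m) ] ind (h ≡ᵇ 1) 1 ≡ 1
∑-oneTo-≡ᵇ1 zero    = refl
∑-oneTo-≡ᵇ1 (suc m) = ∑-oneTo-≡ᵇ1 m

∑-upTo-suc : ∀ n (g : ℕ → ℕ) → ∑ (upTo (suc n)) g ≡ g 0 + ∑[ i ∈ upTo n ] g (suc i)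
∑-upTo-suc n g =
  cong (g 0 +_) (cong sum (trans (map-applyUpTo suc g n) (sym (map-upTo (g ∘ suc) n))))

*-ind : ∀ u b v → u * ind b v ≡ ind b (u * v)
*-ind u true  v = refl
*-ind u false v = *-zeroʳ u

∑-convolution : ∀ n a b u v →
  ∑[ i ∈ upTo (suc n) ] (ind (a ≡ᵇ i) u * ind (b ≡ᵇ n ∸ i) v) ≡ ind (a + b ≡ᵇ n) (u * v)
∑-convolution n zero b u v = begin
    ∑[ i ∈ upTo (suc n) ] (ind (0 ≡ᵇ i) u * ind (b ≡ᵇ n ∸ i) v)
      ≡⟨ ∑-upTo-suc n _ ⟩
    u * ind (b ≡ᵇ n) v + ∑[ i ∈ upTo n ] 0
      ≡⟨ cong (u * ind (b ≡ᵇ n) v +_) (∑-vanish (upTo n) (λ _ → refl)) ⟩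
    u * ind (b ≡ᵇ n) v + 0                  ≡⟨ +-identityʳ _ ⟩
    u * ind (b ≡ᵇ n) v                      ≡⟨ *-ind u (b ≡ᵇ n) v ⟩
    ind (b ≡ᵇ n) (u * v)                    ∎
  where open ≡-Reasoning
∑-convolution zero    (suc a) b u v = refl
∑-convolution (suc n) (suc a) b u v =
  trans (∑-upTo-suc (suc n) (λ i → ind (suc a ≡ᵇ i) u * ind (b ≡ᵇ suc n ∸ i) v))
        (∑-convolution n a b u v)

^S-cong≤ : ∀ {f g : Series} j n → (∀ i → i ≤ n → f i ≡ g i) → (f ^S j) n ≡ (g ^S j) n
^S-cong≤         zero    n f≡g = refl
^S-cong≤ {f} {g} (suc j) n f≡g = cong sum (map-cong-local (applyUpTo⁺₁ id (suc n) term))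
  where
  term : ∀ {i} → i < suc n → f i * (f ^S j) (n ∸ i) ≡ g i * (g ^S j) (n ∸ i)
  term {i} i<1+n = cong₂ _*_ (f≡g i (s≤s⁻¹ i<1+n))
    (^S-cong≤ j (n ∸ i) (λ i′ i′≤n∸i → f≡g i′ (≤-trans i′≤n∸i (m∸n≤m n i))))

∑-allFin-suc : ∀ m (f : Fin (suc m) → ℕ) →
  ∑ (allFin (suc m)) f ≡ f fzero + ∑[ b ∈ allFin m ] f (fsuc b)
∑-allFin-suc m f =
  cong (f fzero +_) (cong sum (trans (map-tabulate fsuc f) (sym (map-tabulate id (f ∘ fsuc)))))

≤ᵇ-suc : ∀ a b → (suc a ≤ᵇ suc b) ≡ (a ≤ᵇ b)
≤ᵇ-suc zero    b = refl
≤ᵇ-suc (suc a) b = refl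

∑-allFin-reindex : ∀ m a (g : ℕ → ℕ) →
  ∑[ b ∈ allFin m ] ind (a ≤ᵇ toℕ b) (g (m ∸ toℕ b)) ≡ ∑[ h ∈ oneTo (m ∸ a) ] g h
∑-allFin-reindex zero    zero    g = refl
∑-allFin-reindex zero    (suc a) g = refl
∑-allFin-reindex (suc m) zero    g =
  trans (∑-allFin-suc m _) (cong (g (suc m) +_) (∑-allFin-reindex m zero g))
∑-allFin-reindex (suc m) (suc a) g =
  trans (∑-allFin-suc m (λ b → ind (suc a ≤ᵇ toℕ b) (g (suc m ∸ toℕ b))))
    (trans (∑-cong (allFin m) (λ b → cong (λ c → ind c (g (m ∸ toℕ b))) (≤ᵇ-suc a (toℕ b))))
           (∑-allFin-reindex m a g))

sumV : ∀ {n} → (A → ℕ) → Vec A n → ℕ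
sumV w []       = 0
sumV w (x ∷ xs) = w x + sumV w xs

prodV : ∀ {n} → (A → ℕ) → Vec A n → ℕ
prodV f []       = 1
prodV f (x ∷ xs) = f x * prodV f xs

allV : ∀ {n} → (A → Bool) → Vec A n → Bool
allV p []       = true
allV p (x ∷ xs) = p x ∧ allV p xs

sumV-≥-length : ∀ {w : A → ℕ} → (∀ x → 1 ≤ w x) → ∀ {n} (xs : Vec A n) → n ≤ sumV w xs
sumV-≥-length w≥1 []       = z≤n
sumV-≥-length w≥1 (x ∷ xs) = +-mono-≤ (w≥1 x) (sumV-≥-length w≥1 xs)

∑-concatMap-∷ : ∀ {n} (xs : List A) (vs : List (Vec A n)) (g : Vec A (suc n) → ℕ) →
  ∑ (concatMap (λ x → map (x ∷_) vs) xs) g ≡ ∑[ x ∈ xs ] ∑[ v ∈ vs ] g (x ∷ v)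
∑-concatMap-∷ xs vs g = trans (∑-concatMap _ xs g) (∑-cong xs (λ x → ∑-map (x ∷_) vs g))

series : (A → ℕ) → (A → ℕ) → List A → Series
series w f xs n = ∑[ x ∈ xs ] ind (w x ≡ᵇ n) (f x)

series-vecsOver : ∀ (w f : A → ℕ) (xs : List A) j →
  series (sumV w) (prodV f) (vecsOver j xs) ≋ series w f xs ^S j
series-vecsOver w f xs zero    zero    = refl
series-vecsOver w f xs zero    (suc n) = refl
series-vecsOver {A = A} w f xs (suc j) n = begin
    series (sumV w) (prodV f) (vecsOver (suc j) xs) n
  ≡⟨ ∑-concatMap-∷ xs V _ ⟩
    ∑[ x ∈ xs ] ∑[ ts ∈ V ] ind (w x + sumV w ts ≡ᵇ n) (f x * prodV f ts)
  ≡⟨ ∑-cong xs (λ x → ∑-cong V (λ ts → sym (∑-convolution n (w x) (sumV w ts) (f x) (prodV f ts)))) ⟩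
    ∑[ x ∈ xs ] ∑[ ts ∈ V ] ∑[ i ∈ I ] term i x ts
  ≡⟨ ∑-cong xs (λ x → ∑-comm V I (λ ts i → term i x ts)) ⟩
    ∑[ x ∈ xs ] ∑[ i ∈ I ] ∑[ ts ∈ V ] term i x ts
  ≡⟨ ∑-comm xs I (λ x i → ∑[ ts ∈ V ] term i x ts) ⟩
    ∑[ i ∈ I ] ∑[ x ∈ xs ] ∑[ ts ∈ V ] term i x ts
  ≡⟨ ∑-cong I (λ i → sym (∑-*-∑ xs V _ _)) ⟩
    ∑[ i ∈ I ] (series w f xs i * series (sumV w) (prodV f) V (n ∸ i))
  ≡⟨ ∑-cong I (λ i → cong (series w f xs i *_) (series-vecsOver w f xs j (n ∸ i))) ⟩
    (series w f xs ^S suc j) n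
  ∎
  where
  open ≡-Reasoning
  V = vecsOver j xs
  I = upTo (suc n)
  term : ℕ → A → Vec A j → ℕ
  term i x ts = ind (w x ≡ᵇ i) (f x) * ind (sumV w ts ≡ᵇ n ∸ i) (prodV f ts)

AgreeBelow : (A → ℕ) → ℕ → List A → List A → Set
AgreeBelow w B xs ys = ∀ g → (∀ x → B ≤ w x → g x ≡ 0) → ∑ xs g ≡ ∑ ys g

vecsOver-agreeBelow : ∀ {w : A → ℕ} {B xs ys} → (∀ x → 1 ≤ w x) → AgreeBelow w B xs ys →
  ∀ n → AgreeBelow (sumV w) (n + B) (vecsOver (suc n) xs) (vecsOver (suc n) ys)
vecsOver-agreeBelow {A = A} {w} {B} {xs} {ys} w≥1 agree n g vanish = begin
    ∑ (vecsOver (suc n) xs) g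
  ≡⟨ ∑-concatMap-∷ xs (vecsOver n xs) g ⟩
    ∑[ x ∈ xs ] ∑[ ts ∈ vecsOver n xs ] g (x ∷ ts)
  ≡⟨ ∑-cong xs (tails-agree n g vanish) ⟩
    ∑[ x ∈ xs ] ∑[ ts ∈ vecsOver n ys ] g (x ∷ ts)
  ≡⟨ agree _ (λ x B≤wx → ∑-vanish (vecsOver n ys) (λ ts → vanish (x ∷ ts) (heavy B≤wx ts))) ⟩
    ∑[ x ∈ ys ] ∑[ ts ∈ vecsOver n ys ] g (x ∷ ts)
  ≡⟨ sym (∑-concatMap-∷ ys (vecsOver n ys) g) ⟩
    ∑ (vecsOver (suc n) ys) g
  ∎
  where
  open ≡-Reasoning
  heavy : ∀ {x} → B ≤ w x → (ts : Vec A n) → n + B ≤ w x + sumV w ts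
  heavy B≤wx ts =
    subst (n + B ≤_) (+-comm (sumV w ts) _) (+-mono-≤ (sumV-≥-length w≥1 ts) B≤wx)
  tails-agree : ∀ m (h : Vec A (suc m) → ℕ) → (∀ vs → m + B ≤ sumV w vs → h vs ≡ 0) →
    ∀ x → ∑[ ts ∈ vecsOver m xs ] h (x ∷ ts) ≡ ∑[ ts ∈ vecsOver m ys ] h (x ∷ ts)
  tails-agree zero    h _         x = refl
  tails-agree (suc m) h h-vanish x =
    vecsOver-agreeBelow {xs = xs} {ys} w≥1 agree m (λ ts → h (x ∷ ts))
    (λ ts m+B≤ → h-vanish (x ∷ ts) (+-mono-≤ (w≥1 x) m+B≤))

module _ {k : ℕ} where

  admissible : Bool → (m : ℕ) → LTree k m → Bool
  admissible false m μ = isMorphism m μ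
  admissible true  m μ = isMorphism m μ ∧ leavesAtTop m μ

  admissibleAbove : Bool → (m : ℕ) → ℕ → LTree k m → Bool
  admissibleAbove r m a μ = (a ≤ᵇ toℕ (rootLabel μ)) ∧ admissible r m μ

  sonsOK≡allV : ∀ m b {n} (ls : Vec (LTree k m) n) →
    sonsOK m b ls ≡ allV (admissibleAbove false m (toℕ b)) ls
  sonsOK≡allV m b []       = refl
  sonsOK≡allV m b (l ∷ ls) =
    trans (sym (∧-assoc (toℕ b ≤ᵇ toℕ (rootLabel l)) _ _)) (cong (_ ∧_) (sonsOK≡allV m b ls))

  sonsOK∧leavesAtTopV≡allV : ∀ m b {n} (ls : Vec (LTree k m) n) →
    (sonsOK m b ls ∧ leavesAtTopV m ls) ≡ allV (admissibleAbove true m (toℕ b)) ls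
  sonsOK∧leavesAtTopV≡allV m b []       = refl
  sonsOK∧leavesAtTopV≡allV m b (l ∷ ls) = begin
      (x ∧ (isMorphism m l ∧ sonsOK m b ls)) ∧ (leavesAtTop m l ∧ leavesAtTopV m ls)
    ≡⟨ ∧-assoc x _ _ ⟩
      x ∧ ((isMorphism m l ∧ sonsOK m b ls) ∧ (leavesAtTop m l ∧ leavesAtTopV m ls))
    ≡⟨ cong (x ∧_) (∧-interchange (isMorphism m l) _ _ _) ⟩
      x ∧ ((isMorphism m l ∧ leavesAtTop m l) ∧ (sonsOK m b ls ∧ leavesAtTopV m ls))
    ≡⟨ sym (∧-assoc x _ _) ⟩
      (x ∧ (isMorphism m l ∧ leavesAtTop m l)) ∧ (sonsOK m b ls ∧ leavesAtTopV m ls)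
    ≡⟨ cong (_ ∧_) (sonsOK∧leavesAtTopV≡allV m b ls) ⟩
      allV (admissibleAbove true m (toℕ b)) (l ∷ ls)
    ∎
    where
    open ≡-Reasoning
    x = toℕ b ≤ᵇ toℕ (rootLabel l)

  admissible-lnode : ∀ r m b (ls : Vec (LTree k m) k) →
    admissible r m (lnode b ls) ≡ allV (admissibleAbove r m (toℕ b)) ls
  admissible-lnode false m b ls = sonsOK≡allV m b ls
  admissible-lnode true  m b ls = sonsOK∧leavesAtTopV≡allV m b ls

  toℕ≡ᵇm∸1≡m∸toℕ≡ᵇ1 : ∀ {m} (b : Fin m) → (toℕ b ≡ᵇ m ∸ 1) ≡ (m ∸ toℕ b ≡ᵇ 1)
  toℕ≡ᵇm∸1≡m∸toℕ≡ᵇ1 {suc zero}    fzero    = refl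
  toℕ≡ᵇm∸1≡m∸toℕ≡ᵇ1 {suc (suc m)} fzero    = refl
  toℕ≡ᵇm∸1≡m∸toℕ≡ᵇ1 {suc (suc m)} (fsuc b) = toℕ≡ᵇm∸1≡m∸toℕ≡ᵇ1 b

  -- morphismCount r p T counts the morphisms T → {1,…,p} (the restricted ones if r),
  -- rootedCount r h T those into {1,…,h} that send the root to 1.
  mutual
    morphismCount : Bool → ℕ → Tree k → ℕ
    morphismCount r p T = ∑[ h ∈ oneTo p ] rootedCount r h T

    rootedCount : Bool → ℕ → Tree k → ℕ
    rootedCount r     h (node ts) = morphismCountProd r h ts
    rootedCount false h leaf      = 1
    rootedCount true  h leaf      = ind (h ≡ᵇ 1) 1

    morphismCountProd : ∀ {n} → Bool → ℕ → Vec (Tree k) n → ℕ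
    morphismCountProd r h []       = 1
    morphismCountProd r h (t ∷ ts) = morphismCount r h t * morphismCountProd r h ts

  admissible-lleaf : ∀ r m (b : Fin m) →
    ind (admissible r m (lleaf b)) 1 ≡ rootedCount r (m ∸ toℕ b) leaf
  admissible-lleaf false m b = refl
  admissible-lleaf true  m b = cong (λ c → ind c 1) (toℕ≡ᵇm∸1≡m∸toℕ≡ᵇ1 b)

  count-allV : ∀ m (p : LTree k m → Bool) {n} (ts : Vec (Tree k) n) →
    count (allV p) (labellingsV m ts) ≡ prodV (λ t → count p (labellings m t)) ts
  count-allV m p []       = refl
  count-allV m p (t ∷ ts) = begin
      count (allV p) (labellingsV m (t ∷ ts))
    ≡⟨ ∑-concatMap-∷ (labellings m t) (labellingsV m ts) _ ⟩
      ∑[ l ∈ labellings m t ] ∑[ ls ∈ labellingsV m ts ] ind (p l ∧ allV p ls) 1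
    ≡⟨ ∑-cong (labellings m t) (λ l → ∑-cong (labellingsV m ts) (λ ls → ind-∧-1 (p l) (allV p ls))) ⟩
      ∑[ l ∈ labellings m t ] ∑[ ls ∈ labellingsV m ts ] (ind (p l) 1 * ind (allV p ls) 1)
    ≡⟨ sym (∑-*-∑ (labellings m t) (labellingsV m ts) _ _) ⟩
      count p (labellings m t) * count (allV p) (labellingsV m ts)
    ≡⟨ cong (count p (labellings m t) *_) (count-allV m p ts) ⟩
      prodV (λ t → count p (labellings m t)) (t ∷ ts)
    ∎
    where
    open ≡-Reasoning
    ind-∧-1 : ∀ b c → ind (b ∧ c) 1 ≡ ind b 1 * ind c 1
    ind-∧-1 true  c = sym (+-identityʳ _)
    ind-∧-1 false c = refl

  mutual
    count-admissibleAbove : ∀ r m a (T : Tree k) →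
      count (admissibleAbove r m a) (labellings m T) ≡ morphismCount r (m ∸ a) T
    count-admissibleAbove r m a T =
      trans (count-byRootLabel r m a T) (∑-allFin-reindex m a (λ h → rootedCount r h T))

    count-byRootLabel : ∀ r m a (T : Tree k) →
      count (admissibleAbove r m a) (labellings m T)
        ≡ ∑[ b ∈ allFin m ] ind (a ≤ᵇ toℕ b) (rootedCount r (m ∸ toℕ b) T)
    count-byRootLabel r m a leaf =
      trans (∑-map lleaf (allFin m) _) (∑-cong (allFin m) λ b →
        trans (ind-∧ (a ≤ᵇ toℕ b) _ 1) (cong (ind (a ≤ᵇ toℕ b)) (admissible-lleaf r m b)))
    count-byRootLabel r m a (node ts) =
      trans (∑-concatMap _ (allFin m) _) (∑-cong (allFin m) withRoot)
      where
      open ≡-Reasoning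
      withRoot : ∀ b → count (admissibleAbove r m a) (map (lnode b) (labellingsV m ts))
                         ≡ ind (a ≤ᵇ toℕ b) (morphismCountProd r (m ∸ toℕ b) ts)
      withRoot b = begin
          count (admissibleAbove r m a) (map (lnode b) (labellingsV m ts))
        ≡⟨ ∑-map (lnode b) (labellingsV m ts) _ ⟩
          count (λ ls → (a ≤ᵇ toℕ b) ∧ admissible r m (lnode b ls)) (labellingsV m ts)
        ≡⟨ count-const-∧ (a ≤ᵇ toℕ b) _ (labellingsV m ts) ⟩
          ind (a ≤ᵇ toℕ b) (count (λ ls → admissible r m (lnode b ls)) (labellingsV m ts))
        ≡⟨ cong (ind (a ≤ᵇ toℕ b)) (∑-cong (labellingsV m ts) λ ls →
             cong (λ c → ind c 1) (admissible-lnode r m b ls)) ⟩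
          ind (a ≤ᵇ toℕ b) (count (allV (admissibleAbove r m (toℕ b))) (labellingsV m ts))
        ≡⟨ cong (ind (a ≤ᵇ toℕ b)) (count-allV m _ ts) ⟩
          ind (a ≤ᵇ toℕ b) (prodV (λ t → count (admissibleAbove r m (toℕ b)) (labellings m t)) ts)
        ≡⟨ cong (ind (a ≤ᵇ toℕ b)) (count-admissibleAboveV r m (toℕ b) ts) ⟩
          ind (a ≤ᵇ toℕ b) (morphismCountProd r (m ∸ toℕ b) ts)
        ∎

    count-admissibleAboveV : ∀ r m b {n} (ts : Vec (Tree k) n) →
      prodV (λ t → count (admissibleAbove r m b) (labellings m t)) ts
        ≡ morphismCountProd r (m ∸ b) ts
    count-admissibleAboveV r m b []       = refl
    count-admissibleAboveV r m b (t ∷ ts) =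
      cong₂ _*_ (count-admissibleAbove r m b t) (count-admissibleAboveV r m b ts)

  ρ≡morphismCount : ∀ m (T : Tree k) → ρ m T ≡ morphismCount true m T
  ρ≡morphismCount m = count-admissibleAbove true m 0

  ρ̃≡morphismCount : ∀ m (T : Tree k) → ρ̃ m T ≡ morphismCount false m T
  ρ̃≡morphismCount m = count-admissibleAbove false m 0

  ρ-node : ∀ m (ts : Vec (Tree k) k) → ρ m (node ts) ≡ ∑[ h ∈ oneTo m ] prodV (ρ h) ts
  ρ-node m ts = trans (ρ≡morphismCount m (node ts))
    (∑-cong (oneTo m) (λ h → sym (count-admissibleAboveV true h 0 ts)))

  ρ̃-node : ∀ m (ts : Vec (Tree k) k) → ρ̃ m (node ts) ≡ ∑[ h ∈ oneTo m ] prodV (ρ̃ h) ts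
  ρ̃-node m ts = trans (ρ̃≡morphismCount m (node ts))
    (∑-cong (oneTo m) (λ h → sym (count-admissibleAboveV false h 0 ts)))

  ρ-leaf : ∀ m → ρ (suc m) (leaf {k}) ≡ 1
  ρ-leaf m = trans (ρ≡morphismCount (suc m) leaf) (∑-oneTo-≡ᵇ1 m)

  ρ̃-leaf : ∀ m → ρ̃ m (leaf {k}) ≡ m
  ρ̃-leaf m = trans (ρ̃≡morphismCount m leaf) (∑-oneTo-1 m)

  mutual
    leavesAtTop-one : (μ : LTree k 1) → leavesAtTop 1 μ ≡ true
    leavesAtTop-one (lleaf fzero) = refl
    leavesAtTop-one (lnode _ ls)  = leavesAtTopV-one ls

    leavesAtTopV-one : ∀ {n} (ls : Vec (LTree k 1) n) → leavesAtTopV 1 ls ≡ true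
    leavesAtTopV-one []       = refl
    leavesAtTopV-one (l ∷ ls) = cong₂ _∧_ (leavesAtTop-one l) (leavesAtTopV-one ls)

  ρ-one≡ρ̃-one : (T : Tree k) → ρ 1 T ≡ ρ̃ 1 T
  ρ-one≡ρ̃-one T = ∑-cong (labellings 1 T) λ μ →
    cong (λ c → ind c 1) (trans (cong (isMorphism 1 μ ∧_) (leavesAtTop-one μ)) (∧-identityʳ _))

leaves-positive : ∀ {k} → 1 ≤ k → (T : Tree k) → 1 ≤ leaves T
leaves-positive _          leaf            = s≤s z≤n
leaves-positive (s≤s z≤n) (node (t ∷ ts)) = ≤-trans (leaves-positive (s≤s z≤n) t) (m≤m+n _ _)

leavesV≡sumV : ∀ {k n} (ts : Vec (Tree k) n) → leavesV ts ≡ sumV leaves ts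
leavesV≡sumV []       = refl
leavesV≡sumV (t ∷ ts) = cong (leaves t +_) (leavesV≡sumV ts)

≡ᵇ-< : ∀ {i w} → i < w → (w ≡ᵇ i) ≡ false
≡ᵇ-< {zero}  {suc w} _         = refl
≡ᵇ-< {suc i} {suc w} (s≤s i<w) = ≡ᵇ-< i<w

treesUpTo-agreeBelow : ∀ {k} → 2 ≤ k → ∀ H →
  AgreeBelow leaves (2 + H) (treesUpTo k (suc H)) (treesUpTo k H)
treesUpTo-agreeBelow {k} 2≤k@(s≤s _) zero g vanish =
  cong (g leaf +_) (trans (∑-map node V g) (∑-vanish V λ ts →
    vanish (node ts) (≤-trans 2≤k (subst (k ≤_) (sym (leavesV≡sumV ts))
                                         (sumV-≥-length (leaves-positive (s≤s z≤n)) ts)))))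
  where V = vecsOver k (leaf ∷ [])
treesUpTo-agreeBelow {suc k′} 2≤k@(s≤s 1≤k′) (suc H) g vanish = cong (g leaf +_) (begin
    ∑ (map node (vecsOver (suc k′) L′)) g  ≡⟨ ∑-map node (vecsOver (suc k′) L′) g ⟩
    ∑[ ts ∈ vecsOver (suc k′) L′ ] g (node ts)
      ≡⟨ vecsOver-agreeBelow {xs = L′} {L} (leaves-positive (s≤s z≤n))
           (treesUpTo-agreeBelow 2≤k H) k′ (g ∘ node) heavy ⟩
    ∑[ ts ∈ vecsOver (suc k′) L ] g (node ts)  ≡⟨ sym (∑-map node (vecsOver (suc k′) L) g) ⟩
    ∑ (map node (vecsOver (suc k′) L)) g     ∎)
  where
  open ≡-Reasoning
  L′ = treesUpTo (suc k′) (suc H)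
  L  = treesUpTo (suc k′) H
  heavy : ∀ ts → k′ + (2 + H) ≤ sumV leaves ts → g (node ts) ≡ 0
  heavy ts k′+2+H≤ = vanish (node ts) (subst (3 + H ≤_) (sym (leavesV≡sumV ts))
                                              (≤-trans (+-monoˡ-≤ (2 + H) 1≤k′) k′+2+H≤))

treeSeries : ∀ {k} → (Tree k → ℕ) → Series
treeSeries {k} f n = series leaves f (treesUpTo k n) n

series-treesUpTo-suc : ∀ {k} → 2 ≤ k → (f : Tree k → ℕ) → ∀ H i → i ≤ suc H →
  series leaves f (treesUpTo k (suc H)) i ≡ series leaves f (treesUpTo k H) i
series-treesUpTo-suc 2≤k f H i i≤1+H = treesUpTo-agreeBelow 2≤k H _ λ T 2+H≤ →
  cong (λ c → ind c (f T)) (≡ᵇ-< (≤-trans (s≤s i≤1+H) 2+H≤))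

treesUpTo-series-stable : ∀ {k} → 2 ≤ k → (f : Tree k → ℕ) →
  ∀ H i → i ≤ suc H → series leaves f (treesUpTo k H) i ≡ treeSeries f i
treesUpTo-series-stable 2≤k f H i i≤1+H with m≤n⇒m<n∨m≡n i≤1+H
... | inj₂ refl = sym (series-treesUpTo-suc 2≤k f H (suc H) i≤1+H)
treesUpTo-series-stable 2≤k f zero    .zero _ | inj₁ (s≤s z≤n)     = refl
treesUpTo-series-stable 2≤k f (suc H) i     _ | inj₁ (s≤s i≤1+H) =
  trans (series-treesUpTo-suc 2≤k f H i i≤1+H) (treesUpTo-series-stable 2≤k f H i i≤1+H)

nodeTuples-coefficient : ∀ {k} → 2 ≤ k → (g : Tree k → ℕ) → ∀ n →
  ∑[ ts ∈ vecsOver k (treesUpTo k n) ] ind (leavesV ts ≡ᵇ suc n) (prodV g ts)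
    ≡ (treeSeries g ^S k) (suc n)
nodeTuples-coefficient {k} 2≤k g n = begin
    ∑[ ts ∈ vecsOver k (treesUpTo k n) ] ind (leavesV ts ≡ᵇ suc n) (prodV g ts)
  ≡⟨ ∑-cong (vecsOver k (treesUpTo k n)) (λ ts →
       cong (λ l → ind (l ≡ᵇ suc n) (prodV g ts)) (leavesV≡sumV ts)) ⟩
    series (sumV leaves) (prodV g) (vecsOver k (treesUpTo k n)) (suc n)
  ≡⟨ series-vecsOver leaves g (treesUpTo k n) k (suc n) ⟩
    (series leaves g (treesUpTo k n) ^S k) (suc n)
  ≡⟨ ^S-cong≤ k (suc n) (treesUpTo-series-stable 2≤k g n) ⟩
    (treeSeries g ^S k) (suc n)
  ∎
  where open ≡-Reasoning

ind-1≡ᵇ : ∀ c n → ind (1 ≡ᵇ n) c ≡ (c · tS) n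
ind-1≡ᵇ c zero          = sym (*-zeroʳ c)
ind-1≡ᵇ c (suc zero)    = sym (*-identityʳ c)
ind-1≡ᵇ c (suc (suc n)) = sym (*-zeroʳ c)

treeSeries-recursion : ∀ {k} → 2 ≤ k → (f : ℕ → Tree k → ℕ) →
  (∀ m ts → f m (node ts) ≡ ∑[ h ∈ oneTo m ] prodV (f h) ts) →
  ∀ m → treeSeries (f m) ≋ f m leaf · tS ⊕ ΣS m (λ h → treeSeries (f h) ^S k)
-- Matching on 2 ≤ k makes k a successor, so that every (treeSeries (f h) ^S k) 0 reduces to 0.
treeSeries-recursion {k} (s≤s _) f f-node m zero = sym (begin
    f m leaf * 0 + ΣS m (λ h → treeSeries (f h) ^S k) 0
  ≡⟨ cong₂ _+_ (*-zeroʳ (f m leaf)) (ΣS-oneTo m (λ h → treeSeries (f h) ^S k) 0) ⟩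
    ∑[ h ∈ oneTo m ] (treeSeries (f h) ^S k) 0
  ≡⟨ ∑-vanish (oneTo m) (λ _ → refl) ⟩
    0
  ∎)
  where open ≡-Reasoning
treeSeries-recursion {k} 2≤k f f-node m (suc n) = cong₂ _+_ (ind-1≡ᵇ (f m leaf) (suc n)) (begin
    ∑ (map node V) (λ T → ind (leaves T ≡ᵇ suc n) (f m T))
  ≡⟨ ∑-map node V _ ⟩
    ∑[ ts ∈ V ] ind (leavesV ts ≡ᵇ suc n) (f m (node ts))
  ≡⟨ ∑-cong V (λ ts → trans (cong (ind _) (f-node m ts)) (ind-∑ _ (oneTo m) _)) ⟩
    ∑[ ts ∈ V ] ∑[ h ∈ oneTo m ] ind (leavesV ts ≡ᵇ suc n) (prodV (f h) ts)
  ≡⟨ ∑-comm V (oneTo m) _ ⟩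
    ∑[ h ∈ oneTo m ] ∑[ ts ∈ V ] ind (leavesV ts ≡ᵇ suc n) (prodV (f h) ts)
  ≡⟨ ∑-cong (oneTo m) (λ h → nodeTuples-coefficient 2≤k (f h) n) ⟩
    ∑[ h ∈ oneTo m ] (treeSeries (f h) ^S k) (suc n)
  ≡⟨ sym (ΣS-oneTo m (λ h → treeSeries (f h) ^S k) (suc n)) ⟩
    ΣS m (λ h → treeSeries (f h) ^S k) (suc n)
  ∎)
  where
  open ≡-Reasoning
  V = vecsOver k (treesUpTo k n)

proposition7p3 : (k : ℕ) → 2 ≤ k →
    (y k 1 ≋ ỹ k 1) × (y k 1 ≋ tS ⊕ (y k 1 ^S k)) ×
    (∀ m → 1 ≤ m → y k m ≋ tS ⊕ ΣS m (λ h → y k h ^S k)) ×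
    (∀ m → 1 ≤ m → ỹ k m ≋ m · tS ⊕ ΣS m (λ h → ỹ k h ^S k))
proposition7p3 k 2≤k = y₁≋ỹ₁ , y-recursion 1 (s≤s z≤n) , y-recursion , ỹ-recursion
  where
  y₁≋ỹ₁ : y k 1 ≋ ỹ k 1
  y₁≋ỹ₁ n = ∑-cong (treesUpTo k n) (λ T → cong (ind (leaves T ≡ᵇ n)) (ρ-one≡ρ̃-one T))

  y-recursion : ∀ m → 1 ≤ m → y k m ≋ tS ⊕ ΣS m (λ h → y k h ^S k)
  y-recursion (suc m) _ n = trans (treeSeries-recursion 2≤k ρ ρ-node (suc m) n)
    (cong (_+ ΣS (suc m) (λ h → y k h ^S k) n)
          (trans (cong (λ c → c * tS n) (ρ-leaf m)) (*-identityˡ (tS n))))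

  ỹ-recursion : ∀ m → 1 ≤ m → ỹ k m ≋ m · tS ⊕ ΣS m (λ h → ỹ k h ^S k)
  ỹ-recursion m _ n = trans (treeSeries-recursion 2≤k ρ̃ ρ̃-node m n)
    (cong (λ c → c * tS n + ΣS m (λ h → ỹ k h ^S k) n) (ρ̃-leaf m))
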